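{- Let $F$ be a Morse stack on a normal $d$-pseudomanifold $M$, and let $x$ be a facet of $M$. Then there exists a unique face $m$ of $M$ such that $\{m\}$ is a minimum of $F$ and $m$ is $\Lambda_d$-linked to $x$. Furthermore, there exists a unique $\Lambda_d$-path in $F$ from $m$ to $x$.
   Context: A simplex is a non-empty finite set; its dimension is its cardinality minus one. A complex is a finite set $X$ of simplexes closed under taking non-empty subsets; elements are faces, facets are faces maximal for inclusion. A path in a set of simplexes is a sequence of its elements in which consecutive elements are comparable for inclusion; connected components are defined via such paths. A covering pair (or $p$-pair) is a pair $(x,y)$ of faces with $x\subseteq y$, $\dim y=p$, $\dim x=p-1$. A strong $d$-path is a path in which each two consecutive elements form a $d$-pair in one order or the other. A subset of $X$ is open if closed under supersets within $X$. A normal $d$-pseudomanifold ($d\ge1$) is a connected complex $M$ whose facets all have dimension $d$, in which each $(d-1)$-face lies in exactly two $d$-faces, and every connected open subset $S$ is strongly connected (any two facets of $S$ joined by a strong $d$-path in $S$). A stack on $X$ is $F:X\to\mathbb Z$ with $F(x)\ge F(y)$ whenever $x\subseteq y$; $F[\lambda]=\{x:F(x)\ge\lambda\}$; a minimum of $F$ (at altitude $\lambda$) is a connected component $A$ of $X\setminus F[\lambda+1]$ with $A\cap(X\setminus F[\lambda])=\emptyset$. A flat pair is a covering pair $(x,y)$ with $F(x)=F(y)$; $F$ is a Morse stack if each face is in at most one flat pair. If $(x,y)$ is a covering pair with $F(x)>F(y)$, then $(y,x)$ is a differential pair. $\mathrm{grad}_p(F)$: flat pairs $(x,y)$ with $\dim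 y=p$; $\mathrm{diff}_p(F)$: differential pairs $(y,x)$ with $\dim y=p$. A $\Lambda_p$-path in $F$ from $x_0$ to $x_k$ is a sequence $\langle x_0,\dots,x_k\rangle$ ($k\ge0$) of faces with each $(x_i,x_{i+1})\in\mathrm{grad}_p(F)\cup\mathrm{diff}_p(F)$. A face $a$ is $\Lambda_p$-linked to $b$ if there is a $\Lambda_p$-path in $F$ from $a$ to $b$. -}

module Defs where

open import Data.Nat using (ℕ; zero; suc)
open import Data.Integer as ℤ using (ℤ; _≤_; _<_; _+_; 1ℤ)
open import Data.Fin.Subset using (Subset; _⊆_; ∣_∣; Nonempty)
open import Data.List using (List; []; _∷_)
open import Data.List.Membership.Propositional renaming (_∈_ to _∈ˡ_)
open import Data.Product using (Σ; ∃; ∃-syntax; _×_; _,_)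
open import Data.Sum using (_⊎_)
open import Relation.Nullary using (¬_)
open import Relation.Binary.PropositionalEquality using (_≡_; _≢_)

-- Vertices are the elements of Fin n; a simplex is a non-empty subset of Fin n.
-- dim x = ∣ x ∣ - 1, so "dim x = p" is written  ∣ x ∣ ≡ suc p.
Simplex : ℕ → Set
Simplex n = Subset n

SimplexSet : ℕ → Set₁
SimplexSet n = Simplex n → Set

-- A finite set of simplexes given by a list (duplicates are irrelevant).
Complex : ℕ → Set
Complex n = List (Simplex n)

module _ {n : ℕ} where

  _∈X_ : Simplex n → Complex n → Set
  x ∈X X = x ∈ˡ X

  asSet : Complex n → SimplexSet n
  asSet X x = x ∈X X

  IsComplex : Complex n → Set
  IsComplex X = (∀ x → x ∈X X → Nonempty x)
              × (∀ x y → x ∈X X → y ⊆ x → Nonempty y → y ∈X X)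

  Comparable : Simplex n → Simplex n → Set
  Comparable x y = x ⊆ y ⊎ y ⊆ x

  -- A chain  ⟨ a , b₁ , … , bₖ ⟩  (written as a and the list b₁ … bₖ)
  -- in which consecutive elements are related by R.
  data Chain (R : Simplex n → Simplex n → Set) : Simplex n → List (Simplex n) → Set where
    []  : ∀ {a} → Chain R a []
    _∷_ : ∀ {a b bs} → R a b → Chain R b bs → Chain R a (b ∷ bs)

  lastOf : Simplex n → List (Simplex n) → Simplex n
  lastOf a []       = a
  lastOf a (b ∷ bs) = lastOf b bs

  SeqFromTo : (Simplex n → Simplex n → Set) → Simplex n → Simplex n → List (Simplex n) → Set
  SeqFromTo R a b bs = Chain R a bs × lastOf a bs ≡ b

  PathIn : SimplexSet n → Simplex n → Simplex n → Set
  PathIn S a b = S a × ∃[ bs ] SeqFromTo (λ u v → S v × Comparable u v) a b bs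

  Connected : SimplexSet n → Set
  Connected S = (∃[ a ] S a) × (∀ a b → S a → S b → PathIn S a b)

  ConnectedComponent : SimplexSet n → SimplexSet n → Set
  ConnectedComponent A T =
      (∀ a → A a → T a)
    × Connected A
    × (∀ a b → A a → T b → Comparable a b → A b)

  CoveringPair : Complex n → Simplex n → Simplex n → Set
  CoveringPair X x y = x ∈X X × y ∈X X × x ⊆ y × ∣ y ∣ ≡ suc ∣ x ∣

  PPair : Complex n → ℕ → Simplex n → Simplex n → Set
  PPair X p x y = CoveringPair X x y × ∣ y ∣ ≡ suc p

  FacetOf : SimplexSet n → Simplex n → Set
  FacetOf S x = S x × (∀ y → S y → x ⊆ y → y ≡ x)

  Facet : Complex n → Simplex n → Set
  Facet X = FacetOf (asSet X)

  StrongPathIn : Complex n → ℕ → SimplexSet n → Simplex n → Simplex n → Set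
  StrongPathIn X d S a b =
    S a × ∃[ bs ] SeqFromTo (λ u v → S v × (PPair X d u v ⊎ PPair X d v u)) a b bs

  StronglyConnected : Complex n → ℕ → SimplexSet n → Set
  StronglyConnected X d S = ∀ a b → FacetOf S a → FacetOf S b → StrongPathIn X d S a b

  Open : Complex n → SimplexSet n → Set
  Open X S = (∀ x → S x → x ∈X X) × (∀ x y → S x → y ∈X X → x ⊆ y → S y)

  NormalPseudomanifold : ℕ → Complex n → Set₁
  NormalPseudomanifold d M =
      1 Data.Nat.≤ d
    × IsComplex M
    × Connected (asSet M)
    × (∀ x → Facet M x → ∣ x ∣ ≡ suc d)
    × (∀ x → x ∈X M → ∣ x ∣ ≡ d →
         ∃[ y₁ ] ∃[ y₂ ] (y₁ ≢ y₂
           × (y₁ ∈X M × x ⊆ y₁ × ∣ y₁ ∣ ≡ suc d)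
           × (y₂ ∈X M × x ⊆ y₂ × ∣ y₂ ∣ ≡ suc d)
           × (∀ y → y ∈X M → x ⊆ y → ∣ y ∣ ≡ suc d → y ≡ y₁ ⊎ y ≡ y₂)))
    × (∀ (S : SimplexSet n) → Open M S → Connected S → StronglyConnected M d S)

  -- Stacks (F is defined on all simplexes; only its values on X matter)
  Stack : Complex n → (Simplex n → ℤ) → Set
  Stack X F = ∀ x y → x ∈X X → y ∈X X → x ⊆ y → F y ≤ F x

  Level : Complex n → (Simplex n → ℤ) → ℤ → SimplexSet n
  Level X F l x = x ∈X X × l ≤ F x

  Below : Complex n → (Simplex n → ℤ) → ℤ → SimplexSet n
  Below X F l x = x ∈X X × ¬ Level X F l x

  MinimumAt : Complex n → (Simplex n → ℤ) → ℤ → SimplexSet n → Set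
  MinimumAt X F l A =
      ConnectedComponent A (Below X F (l + 1ℤ))
    × (∀ a → A a → ¬ Below X F l a)

  Minimum : Complex n → (Simplex n → ℤ) → SimplexSet n → Set
  Minimum X F A = ∃[ l ] MinimumAt X F l A

  Singleton : Simplex n → SimplexSet n
  Singleton m y = y ≡ m

  FlatPair : Complex n → (Simplex n → ℤ) → Simplex n → Simplex n → Set
  FlatPair X F x y = CoveringPair X x y × F x ≡ F y

  -- each face is in at most one flat pair
  MorseStack : Complex n → (Simplex n → ℤ) → Set
  MorseStack X F = Stack X F
    × (∀ z x y x' y' → FlatPair X F x y → FlatPair X F x' y' →
         (z ≡ x ⊎ z ≡ y) → (z ≡ x' ⊎ z ≡ y') → (x ≡ x' × y ≡ y'))

  Grad : Complex n → (Simplex n → ℤ) → ℕ → Simplex n → Simplex n → Set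
  Grad X F p x y = FlatPair X F x y × ∣ y ∣ ≡ suc p

  -- diff_p(F): differential pairs (y , x), i.e. (x , y) covering with F x > F y,
  -- and dim y = p
  Diff : Complex n → (Simplex n → ℤ) → ℕ → Simplex n → Simplex n → Set
  Diff X F p y x = CoveringPair X x y × F y < F x × ∣ y ∣ ≡ suc p

  ΛStep : Complex n → (Simplex n → ℤ) → ℕ → Simplex n → Simplex n → Set
  ΛStep X F p u v = Grad X F p u v ⊎ Diff X F p u v

  ΛPath : Complex n → (Simplex n → ℤ) → ℕ → Simplex n → Simplex n → List (Simplex n) → Set
  ΛPath X F p a b bs = SeqFromTo (ΛStep X F p) a b bs

  ΛLinked : Complex n → (Simplex n → ℤ) → ℕ → Simplex n → Simplex n → Set
  ΛLinked X F p a b = ∃[ bs ] ΛPath X F p a b bs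

-- Existence: walk backwards from the facet x. If the current d-face y forms a flat pair
-- (w , y), the other d-coface y' of w lies strictly below w, since a second flat pair at w
-- would violate the Morse condition; so y' , w , y prolongs the Λ_d-path backwards while F
-- strictly decreases. On a finite complex this ends at a d-face with no flat pair below it,
-- and such a face is a minimum.
-- Uniqueness: a d-face, or the lower face of a gradient pair, has at most one Λ_d-predecessor,
-- which is again of one of these two kinds, while a minimum has no predecessor at all. Hence a
-- Λ_d-path from a minimum into x is traced back from x deterministically.
module Submission where

open import Defs
open import Data.Nat using (ℕ)
open import Data.Integer using (ℤ)
open import Data.List using (List; _∷_)
open import Data.Product using (_×_; ∃-syntax)
open import Relation.Binary.PropositionalEquality using (_≡_)

open import Data.Nat as ℕ using (suc; _∸_)
import Data.Nat.Properties as ℕ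
open import Data.Nat.Induction using (<-wellFounded)
open import Data.Integer using (_+_; 1ℤ; _<?_) renaming (_≤_ to _≤ℤ_; _<_ to _<ℤ_)
import Data.Integer.Properties as ℤ
open import Data.Fin.Subset using (Subset; _⊆_; _⊂_; _⊃_; _∈_; _-_; ∣_∣; outside; inside)
open import Data.Fin.Subset.Properties
  using (_∈?_; _⊆?_; _⊂?_; ⊆-antisym; ⊆-trans; p─q⊆p; p─⊥≡p; x∈p∧x∉q⇒x∈p─q; x≢y⇒x∉⁅y⁆;
         p⊂q⇒∣p∣<∣q∣; ∣p∣≤n)
open import Data.Vec using (_∷_; here; there)
open import Data.Vec.Properties using (≡-dec)
import Data.Bool.Properties as Bool
open import Data.List using ([]; _∷ʳ_)
open import Data.List.Relation.Unary.Any using (here; there; any?)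
open import Data.List.Membership.Propositional using (find; lose) renaming (_∈_ to _∈ˡ_)
open import Data.Product using (∃; _,_; proj₁; proj₂)
open import Data.Sum using (_⊎_; inj₁; inj₂)
open import Induction.WellFounded using (WellFounded; Acc; acc; module Subrelation)
import Relation.Binary.Construct.On as On
open import Relation.Nullary using (¬_; yes; no; contradiction)
open import Relation.Nullary.Decidable using (_×-dec_; decidable-stable)
open import Relation.Binary.Definitions using (Decidable)
open import Relation.Binary.PropositionalEquality using (refl; sym; trans; cong; _≢_)

module _ {n : ℕ} where

  ⊆⇒≡⊎⊂ : {p q : Subset n} → p ⊆ q → p ≡ q ⊎ p ⊂ q
  ⊆⇒≡⊎⊂ {p} {q} p⊆q with p ⊂? q
  ... | yes p⊂q = inj₂ p⊂q
  ... | no p⊄q  = inj₁ (⊆-antisym p⊆q q⊆p)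
    where
    q⊆p : q ⊆ p
    q⊆p {x} x∈q = decidable-stable (x ∈? p) (λ x∉p → p⊄q (p⊆q , x , x∈q , x∉p))

  ⊃-wellFounded : WellFounded (_⊃_ {n})
  ⊃-wellFounded = Subrelation.wellFounded ⊃⇒co-size-<
    (On.wellFounded (λ p → n ∸ ∣ p ∣) <-wellFounded)
    where
    ⊃⇒co-size-< : {p q : Subset n} → p ⊃ q → n ∸ ∣ p ∣ ℕ.< n ∸ ∣ q ∣
    ⊃⇒co-size-< {p} q⊂p = ℕ.∸-monoʳ-< (p⊂q⇒∣p∣<∣q∣ q⊂p) (∣p∣≤n p)

∣p∣≡1+∣p-x∣ : ∀ {n} (p : Subset n) {x} → x ∈ p → ∣ p ∣ ≡ suc ∣ p - x ∣
∣p∣≡1+∣p-x∣ (inside ∷ p)  here      = cong suc (cong ∣_∣ (sym (p─⊥≡p p)))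
∣p∣≡1+∣p-x∣ (inside ∷ p)  (there x) = cong suc (∣p∣≡1+∣p-x∣ p x)
∣p∣≡1+∣p-x∣ (outside ∷ p) (there x) = ∣p∣≡1+∣p-x∣ p x

+1≤⇒< : ∀ {i j} → i + 1ℤ ≤ℤ j → i <ℤ j
+1≤⇒< {i} i+1≤j = ℤ.suc[i]≤j⇒i<j (ℤ.≤-trans (ℤ.≤-reflexive (ℤ.+-comm 1ℤ i)) i+1≤j)

<⇒+1≤ : ∀ {i j} → i <ℤ j → i + 1ℤ ≤ℤ j
<⇒+1≤ {i} i<j = ℤ.≤-trans (ℤ.≤-reflexive (ℤ.+-comm i 1ℤ)) (ℤ.i<j⇒suc[i]≤j i<j)

module _ {A : Set} (f : A → ℤ) where

  countBelow : ℤ → List A → ℕ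
  countBelow v [] = 0
  countBelow v (a ∷ as) with f a <? v
  ... | yes _ = suc (countBelow v as)
  ... | no _  = countBelow v as

  countBelow-mono : ∀ {u v} as → u ≤ℤ v → countBelow u as ℕ.≤ countBelow v as
  countBelow-mono []       u≤v = ℕ.z≤n
  countBelow-mono {u} {v} (a ∷ as) u≤v with f a <? u | f a <? v
  ... | yes _   | yes _   = ℕ.s≤s (countBelow-mono as u≤v)
  ... | yes a<u | no  a≮v = contradiction (ℤ.<-≤-trans a<u u≤v) a≮v
  ... | no  _   | yes _   = ℕ.m≤n⇒m≤1+n (countBelow-mono as u≤v)
  ... | no  _   | no  _   = countBelow-mono as u≤v

  countBelow-< : ∀ {a v} as → a ∈ˡ as → f a <ℤ v → countBelow (f a) as ℕ.< countBelow v as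
  countBelow-< {a} {v} (a ∷ as) (here refl) a<v with f a <? f a | f a <? v
  ... | yes a<a | _       = contradiction a<a (ℤ.<-irrefl refl)
  ... | no  _   | yes _   = ℕ.s≤s (countBelow-mono as (ℤ.<⇒≤ a<v))
  ... | no  _   | no  a≮v = contradiction a<v a≮v
  countBelow-< {a} {v} (b ∷ as) (there a∈as) a<v with f b <? f a | f b <? v
  ... | yes _   | yes _   = ℕ.s≤s (countBelow-< as a∈as a<v)
  ... | yes b<a | no  b≮v = contradiction (ℤ.<-trans b<a a<v) b≮v
  ... | no  _   | yes _   = ℕ.m≤n⇒m≤1+n (countBelow-< as a∈as a<v)
  ... | no  _   | no  _   = countBelow-< as a∈as a<v

  module _ (as : List A) where

    _≺_ : A → A → Set
    a ≺ b = a ∈ˡ as × f a <ℤ f b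

    ≺-wellFounded : WellFounded _≺_
    ≺-wellFounded = Subrelation.wellFounded (λ (a∈as , a<b) → countBelow-< as a∈as a<b)
      (On.wellFounded (λ a → countBelow (f a) as) <-wellFounded)

module _ {n : ℕ} (R : Simplex n → Simplex n → Set) where

  data SnocChain (a : Simplex n) : Simplex n → List (Simplex n) → Set where
    []  : SnocChain a a []
    _▷_ : ∀ {u v bs} → SnocChain a u bs → R u v → SnocChain a v (bs ∷ʳ v)

  private
    _◁_ : ∀ {a b c bs} → R a b → SnocChain b c bs → SnocChain a c (b ∷ bs)
    r ◁ []       = [] ▷ r
    r ◁ (s ▷ r') = (r ◁ s) ▷ r'

    chain⇒snoc : ∀ {a bs} → Chain R a bs → SnocChain a (lastOf a bs) bs
    chain⇒snoc []       = []
    chain⇒snoc (r ∷ ch) = r ◁ chain⇒snoc ch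

    _∷ʳᶜ_ : ∀ {a bs v} → Chain R a bs → R (lastOf a bs) v → Chain R a (bs ∷ʳ v)
    []        ∷ʳᶜ r = r ∷ []
    (r' ∷ ch) ∷ʳᶜ r = r' ∷ (ch ∷ʳᶜ r)

    lastOf-∷ʳ : ∀ a bs (v : Simplex n) → lastOf a (bs ∷ʳ v) ≡ v
    lastOf-∷ʳ a []       v = refl
    lastOf-∷ʳ a (b ∷ bs) v = lastOf-∷ʳ b bs v

  toSnoc : ∀ {a b bs} → SeqFromTo R a b bs → SnocChain a b bs
  toSnoc (ch , refl) = chain⇒snoc ch

  fromSnoc : ∀ {a b bs} → SnocChain a b bs → SeqFromTo R a b bs
  fromSnoc []       = [] , refl
  fromSnoc {a} (_▷_ {v = v} {bs} s r) with fromSnoc s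
  ... | ch , refl = ch ∷ʳᶜ r , lastOf-∷ʳ a bs v

module _ {n : ℕ} (M : Complex n) where

  facet-above : ∀ {w} → Acc _⊃_ w → w ∈X M → ∃ λ f → Facet M f × w ⊆ f
  facet-above {w} (acc larger) w∈M with any? (w ⊂?_) M
  ... | yes below = let b , b∈M , w⊂b = find below
                        f , f-facet , b⊆f = facet-above (larger w⊂b) b∈M
                    in f , f-facet , ⊆-trans (proj₁ w⊂b) b⊆f
  ... | no maximal = w , (w∈M , w-maximal) , (λ x∈w → x∈w)
    where
    w-maximal : ∀ b → b ∈X M → w ⊆ b → b ≡ w
    w-maximal b b∈M w⊆b with ⊆⇒≡⊎⊂ w⊆b
    ... | inj₁ w≡b = sym w≡b
    ... | inj₂ w⊂b = contradiction (lose b∈M w⊂b) maximal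

  top-face⇒facet : ∀ {d y} → (∀ x → Facet M x → ∣ x ∣ ≡ suc d) →
                   y ∈X M → ∣ y ∣ ≡ suc d → Facet M y
  top-face⇒facet {y = y} pure y∈M ∣y∣ = y∈M , λ b b∈M y⊆b → y-maximal b b∈M y⊆b
    where
    y-maximal : ∀ b → b ∈X M → y ⊆ b → b ≡ y
    y-maximal b b∈M y⊆b with facet-above (⊃-wellFounded b) b∈M
    ... | f , f-facet , b⊆f with ⊆⇒≡⊎⊂ (⊆-trans y⊆b b⊆f)
    ...   | inj₁ refl = ⊆-antisym b⊆f y⊆b
    ...   | inj₂ y⊂f  = contradiction (trans ∣y∣ (sym (pure f f-facet)))
                                      (ℕ.<⇒≢ (p⊂q⇒∣p∣<∣q∣ y⊂f))

module _ {n : ℕ} {M : Complex n} {F : Simplex n → ℤ} where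

  open import Data.List.Membership.DecPropositional (≡-dec {n = n} Bool._≟_)
    using () renaming (_∈?_ to _∈ˡ?_)

  flatPair? : Decidable (FlatPair M F)
  flatPair? x y = ((x ∈ˡ? M) ×-dec (y ∈ˡ? M) ×-dec (x ⊆? y) ×-dec (∣ y ∣ ℕ.≟ suc ∣ x ∣))
                  ×-dec (F x ℤ.≟ F y)

  -- Remove from y a vertex missing in z; F on the result is squeezed between F z and F y.
  flat-pair-below : IsComplex M → Stack M F → ∀ {y z} → y ∈X M → z ∈X M → z ⊂ y →
                    F z ≡ F y → ∃ λ w → FlatPair M F w y
  flat-pair-below (nonempty , closed) stack {y} {z} y∈M z∈M (z⊆y , i , i∈y , i∉z) Fz≡Fy =
    y - i , ((w∈M , y∈M , p─q⊆p y _ , ∣p∣≡1+∣p-x∣ y i∈y) , Fw≡Fy)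
    where
    z⊆w : z ⊆ y - i
    z⊆w x∈z = x∈p∧x∉q⇒x∈p─q (z⊆y x∈z) (x≢y⇒x∉⁅y⁆ λ { refl → i∉z x∈z })
    w∈M : (y - i) ∈X M
    w∈M = let x , x∈z = nonempty z z∈M in closed y (y - i) y∈M (p─q⊆p y _) (x , z⊆w x∈z)
    Fw≡Fy : F (y - i) ≡ F y
    Fw≡Fy = ℤ.≤-antisym (ℤ.≤-trans (stack z _ z∈M w∈M z⊆w) (ℤ.≤-reflexive Fz≡Fy))
                        (stack _ y w∈M y∈M (p─q⊆p y _))

  singleton-minimum : IsComplex M → Stack M F → ∀ {y} → Facet M y →
                      (∀ w → ¬ FlatPair M F w y) → Minimum M F (Singleton y)
  singleton-minimum isC stack {y} (y∈M , y-maximal) no-flat =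
    F y , ( (λ { _ refl → y∈M , λ (_ , Fy+1≤Fy) → ℤ.<-irrefl refl (+1≤⇒< Fy+1≤Fy) })
          , ((y , refl) , λ { _ _ refl refl → refl , [] , [] , refl })
          , closed-under-comparable)
        , λ { _ refl (_ , Fy≱Fy) → Fy≱Fy (y∈M , ℤ.≤-refl) }
    where
    closed-under-comparable : ∀ a b → a ≡ y → Below M F (F y + 1ℤ) b → Comparable a b → b ≡ y
    closed-under-comparable _ b refl (b∈M , _) (inj₁ y⊆b) = y-maximal b b∈M y⊆b
    closed-under-comparable _ b refl (b∈M , b-low) (inj₂ b⊆y) with ⊆⇒≡⊎⊂ b⊆y
    ... | inj₁ b≡y = b≡y
    ... | inj₂ b⊂y =
      let w , wy-flat = flat-pair-below isC stack y∈M b∈M b⊂y Fb≡Fy in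
      contradiction wy-flat (no-flat w)
      where
      Fb≡Fy : F b ≡ F y
      Fb≡Fy = ℤ.≤-antisym (ℤ.≮⇒≥ (λ Fy<Fb → b-low (b∈M , <⇒+1≤ Fy<Fb)))
                          (stack b y b∈M y∈M b⊆y)

  minimum-isolated : ∀ {m u} → Minimum M F (Singleton m) → u ∈X M → Comparable m u →
                     F u ≤ℤ F m → u ≡ m
  minimum-isolated (l , (m∈A⇒low , _ , closed) , _) u∈M m~u Fu≤Fm with m∈A⇒low _ refl
  ... | m∈M , m-low =
    closed _ _ refl (u∈M , λ (_ , l+1≤Fu) → m-low (m∈M , ℤ.≤-trans l+1≤Fu Fu≤Fm)) m~u

  minimum-has-no-Λ-predecessor : ∀ {p m u} → Minimum M F (Singleton m) → ¬ ΛStep M F p u m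
  minimum-has-no-Λ-predecessor m-min (inj₁ (((u∈M , _ , u⊆m , ∣m∣) , Fu≡Fm) , _))
    with minimum-isolated m-min u∈M (inj₂ u⊆m) (ℤ.≤-reflexive Fu≡Fm)
  ... | refl = ℕ.1+n≢n (sym ∣m∣)
  minimum-has-no-Λ-predecessor m-min (inj₂ ((_ , u∈M , m⊆u , ∣u∣) , Fu<Fm , _))
    with minimum-isolated m-min u∈M (inj₁ m⊆u) (ℤ.<⇒≤ Fu<Fm)
  ... | refl = ℕ.1+n≢n (sym ∣u∣)

among-two : ∀ {A : Set} {a b u u' y : A} → u ≡ a ⊎ u ≡ b → u' ≡ a ⊎ u' ≡ b → y ≡ a ⊎ y ≡ b →
            u ≢ y → u' ≢ y → u ≡ u'
among-two (inj₁ refl) (inj₁ refl) _           _   _    = refl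
among-two (inj₂ refl) (inj₂ refl) _           _   _    = refl
among-two (inj₁ refl) (inj₂ refl) (inj₁ refl) u≢y _    = contradiction refl u≢y
among-two (inj₁ refl) (inj₂ refl) (inj₂ refl) _   u'≢y = contradiction refl u'≢y
among-two (inj₂ refl) (inj₁ refl) (inj₁ refl) _   u'≢y = contradiction refl u'≢y
among-two (inj₂ refl) (inj₁ refl) (inj₂ refl) u≢y _    = contradiction refl u≢y

module _ {n d : ℕ} {M : Complex n} {F : Simplex n → ℤ}
         (pm : NormalPseudomanifold d M) (morse : MorseStack M F) where

  TopCoface : Simplex n → Simplex n → Set
  TopCoface w y = y ∈X M × w ⊆ y × ∣ y ∣ ≡ suc d

  private
    isComplex : IsComplex M
    isComplex = proj₁ (proj₂ pm)

    ridge : ∀ w → w ∈X M → ∣ w ∣ ≡ d → ∃[ y₁ ] ∃[ y₂ ] (y₁ ≢ y₂ × TopCoface w y₁ × TopCoface w y₂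
              × (∀ y → y ∈X M → w ⊆ y → ∣ y ∣ ≡ suc d → y ≡ y₁ ⊎ y ≡ y₂))
    ridge = proj₁ (proj₂ (proj₂ (proj₂ (proj₂ pm))))

    stack : Stack M F
    stack = proj₁ morse

  facet-size : ∀ x → Facet M x → ∣ x ∣ ≡ suc d
  facet-size = proj₁ (proj₂ (proj₂ (proj₂ pm)))

  another-top-coface : ∀ {w y} → w ∈X M → ∣ w ∣ ≡ d → TopCoface w y →
                       ∃ λ y' → y' ≢ y × TopCoface w y'
  another-top-coface w∈M ∣w∣ (y∈M , w⊆y , ∣y∣) with ridge _ w∈M ∣w∣
  ... | y₁ , y₂ , y₁≢y₂ , y₁-coface , y₂-coface , only with only _ y∈M w⊆y ∣y∣
  ...   | inj₁ refl = y₂ , (λ y₂≡y₁ → y₁≢y₂ (sym y₂≡y₁)) , y₂-coface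
  ...   | inj₂ refl = y₁ , y₁≢y₂ , y₁-coface

  top-cofaces-avoiding-agree : ∀ {w y u u'} → w ∈X M → ∣ w ∣ ≡ d →
    TopCoface w y → TopCoface w u → TopCoface w u' → u ≢ y → u' ≢ y → u ≡ u'
  top-cofaces-avoiding-agree w∈M ∣w∣ (y∈M , w⊆y , ∣y∣) (u∈M , w⊆u , ∣u∣) (u'∈M , w⊆u' , ∣u'∣)
    with ridge _ w∈M ∣w∣
  ... | _ , _ , _ , _ , _ , only =
    among-two (only _ u∈M w⊆u ∣u∣) (only _ u'∈M w⊆u' ∣u'∣) (only _ y∈M w⊆y ∣y∣)

  lower-size : ∀ {w y} → CoveringPair M w y → ∣ y ∣ ≡ suc d → ∣ w ∣ ≡ d
  lower-size (_ , _ , _ , ∣y∣≡1+∣w∣) ∣y∣ = ℕ.suc-injective (trans (sym ∣y∣≡1+∣w∣) ∣y∣)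

  -- The Morse condition at w rules out F y' ≡ F w for the second d-coface y'.
  descending-coface : ∀ {w y} → FlatPair M F w y → ∣ y ∣ ≡ suc d → ∃ λ y' → Diff M F d y' w
  descending-coface {w} {y} wy-flat@(wy-cover@(w∈M , y∈M , w⊆y , _) , _) ∣y∣
    with another-top-coface w∈M (lower-size wy-cover ∣y∣) (y∈M , w⊆y , ∣y∣)
  ... | y' , y'≢y , (y'∈M , w⊆y' , ∣y'∣) = y' , (wy'-cover , Fy'<Fw , ∣y'∣)
    where
    wy'-cover : CoveringPair M w y'
    wy'-cover = w∈M , y'∈M , w⊆y' , trans ∣y'∣ (cong suc (sym (lower-size wy-cover ∣y∣)))
    Fy'<Fw : F y' <ℤ F w
    Fy'<Fw with F y' <? F w
    ... | yes Fy'<Fw = Fy'<Fw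
    ... | no  Fy'≮Fw = contradiction y'≡y y'≢y
      where
      wy'-flat : FlatPair M F w y'
      wy'-flat = wy'-cover , ℤ.≤-antisym (ℤ.≮⇒≥ Fy'≮Fw) (stack w y' w∈M y'∈M w⊆y')
      y'≡y : y' ≡ y
      y'≡y = proj₂ (proj₂ morse w w y' w y wy'-flat wy-flat (inj₁ refl) (inj₁ refl))

  ΛSnoc : Simplex n → Simplex n → List (Simplex n) → Set
  ΛSnoc = SnocChain (ΛStep M F d)

  Λ-path-from-minimum : ∀ {y} → Acc (_≺_ F M) y → y ∈X M → ∣ y ∣ ≡ suc d →
                        ∃ λ m → m ∈X M × Minimum M F (Singleton m) × ∃ (ΛSnoc m y)
  Λ-path-from-minimum {y} (acc lower) y∈M ∣y∣ with any? (λ w → flatPair? w y) M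
  ... | no no-flat = y , y∈M , y-minimum , [] , []
    where
    y-minimum : Minimum M F (Singleton y)
    y-minimum = singleton-minimum isComplex stack
      (top-face⇒facet M facet-size y∈M ∣y∣)
      (λ w wy-flat → no-flat (lose (proj₁ (proj₁ wy-flat)) wy-flat))
  ... | yes flat with find flat
  ...   | w , _ , wy-flat with descending-coface wy-flat ∣y∣
  ...     | y' , y'w-diff@((_ , y'∈M , _) , Fy'<Fw , ∣y'∣)
    with Λ-path-from-minimum (lower (y'∈M , ℤ.<-≤-trans Fy'<Fw (ℤ.≤-reflexive (proj₂ wy-flat))))
                             y'∈M ∣y'∣
  ... | m , m∈M , m-min , bs , m⇝y' =
    m , m∈M , m-min , _ , (m⇝y' ▷ inj₂ y'w-diff) ▷ inj₁ (wy-flat , ∣y∣)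

  -- The faces with at most one Λ_d-predecessor (Λ-predecessor-unique).
  data Retraceable (t : Simplex n) : Set where
    top-face    : ∣ t ∣ ≡ suc d → Retraceable t
    grad-source : ∀ {y} → Grad M F d t y → Retraceable t

  Λ-predecessor-unique : ∀ {t u u'} → Retraceable t → ΛStep M F d u t → ΛStep M F d u' t →
                         u ≡ u' × Retraceable u
  Λ-predecessor-unique {t} (top-face _) (inj₁ ut-grad) (inj₁ u't-grad) =
    proj₁ (proj₂ morse t _ t _ t (proj₁ ut-grad) (proj₁ u't-grad) (inj₂ refl) (inj₂ refl)) ,
    grad-source ut-grad
  Λ-predecessor-unique (top-face ∣t∣) (inj₂ (ut-cover , _ , ∣u∣)) _ =
    contradiction (trans (sym ∣t∣) (lower-size ut-cover ∣u∣)) ℕ.1+n≢n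
  Λ-predecessor-unique (top-face ∣t∣) (inj₁ _) (inj₂ (u't-cover , _ , ∣u'∣)) =
    contradiction (trans (sym ∣t∣) (lower-size u't-cover ∣u'∣)) ℕ.1+n≢n
  Λ-predecessor-unique (grad-source ((ty-cover , _) , ∣y∣)) (inj₁ (_ , ∣t∣)) _ =
    contradiction (trans (sym ∣t∣) (lower-size ty-cover ∣y∣)) ℕ.1+n≢n
  Λ-predecessor-unique (grad-source ((ty-cover , _) , ∣y∣)) (inj₂ _) (inj₁ (_ , ∣t∣)) =
    contradiction (trans (sym ∣t∣) (lower-size ty-cover ∣y∣)) ℕ.1+n≢n
  Λ-predecessor-unique (grad-source ((ty-cover@(t∈M , y∈M , t⊆y , _) , Ft≡Fy) , ∣y∣))
                       (inj₂ ((_ , u∈M , t⊆u , _) , Fu<Ft , ∣u∣))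
                       (inj₂ ((_ , u'∈M , t⊆u' , _) , Fu'<Ft , ∣u'∣)) =
    top-cofaces-avoiding-agree t∈M (lower-size ty-cover ∣y∣)
      (y∈M , t⊆y , ∣y∣) (u∈M , t⊆u , ∣u∣) (u'∈M , t⊆u' , ∣u'∣)
      (λ { refl → ℤ.<-irrefl (sym Ft≡Fy) Fu<Ft }) (λ { refl → ℤ.<-irrefl (sym Ft≡Fy) Fu'<Ft }) ,
    top-face ∣u∣

  Λ-paths-from-minima-agree : ∀ {m m' t bs cs} →
    Minimum M F (Singleton m) → Minimum M F (Singleton m') → Retraceable t →
    ΛSnoc m t bs → ΛSnoc m' t cs → m ≡ m' × bs ≡ cs
  Λ-paths-from-minima-agree m-min m'-min t-ret []       []         = refl , refl
  Λ-paths-from-minima-agree m-min m'-min t-ret []       (_ ▷ step) =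
    contradiction step (minimum-has-no-Λ-predecessor m-min)
  Λ-paths-from-minima-agree m-min m'-min t-ret (_ ▷ step) []       =
    contradiction step (minimum-has-no-Λ-predecessor m'-min)
  Λ-paths-from-minima-agree m-min m'-min t-ret (s ▷ step) (s' ▷ step')
    with Λ-predecessor-unique t-ret step step'
  ... | refl , u-ret with Λ-paths-from-minima-agree m-min m'-min u-ret s s'
  ...   | refl , refl = refl , refl

proposition4 : (n d : ℕ) (M : Complex n) (F : Simplex n → ℤ) →
    NormalPseudomanifold d M → MorseStack M F →
    (x : Simplex n) → Facet M x →
    ∃[ m ] ((m ∈X M × Minimum M F (Singleton m) × ΛLinked M F d m x)
      × (∀ m' → m' ∈X M → Minimum M F (Singleton m') → ΛLinked M F d m' x → m' ≡ m)
      × (∀ bs cs → ΛPath M F d m x bs → ΛPath M F d m x cs → m ∷ bs ≡ m ∷ cs))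
proposition4 n d M F pm morse x x-facet@(x∈M , _) =
  let m , m∈M , m-min , bs , m⇝x = Λ-path-from-minimum pm morse (≺-wellFounded F M x) x∈M ∣x∣
      agree = Λ-paths-from-minima-agree pm morse
  in m , (m∈M , m-min , bs , fromSnoc _ m⇝x)
       , (λ { m' _ m'-min (cs , m'⇝x) → proj₁ (agree m'-min m-min x-top (toSnoc _ m'⇝x) m⇝x) })
       , (λ bs cs p q → cong (m ∷_) (proj₂ (agree m-min m-min x-top (toSnoc _ p) (toSnoc _ q))))
  where
  ∣x∣ : ∣ x ∣ ≡ suc d
  ∣x∣ = facet-size pm morse x x-facet
  x-top : Retraceable pm morse x
  x-top = top-face ∣x∣
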